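{- Let $(u,v)\in k(x)^n\times k(x)^m$. There exist circuits $c_u\in\mathsf{ACirc}[0,n]$ and $c_v\in\mathsf{ACirc}[m,0]$ such that $[\![c_u]\!]=\{(\bullet,u)\}$ and $[\![c_v]\!]=\{(v,\bullet)\}$.
   Context: Fix a field $k$; $k(x)$ is the field of fractions of polynomials in $x$ over $k$. Circuits and sorts $(n,m)$: generators copier $\Delta:(1,2)$, discard $!:(1,0)$, adder $\mu:(2,1)$, zero $\mathsf 0:(0,1)$, one $\mathsf 1:(0,1)$, register $\mathsf x:(1,1)$, amplifier $\mathsf s_r:(1,1)$ ($r\in k$), mirror images $\Delta^{op}:(2,1)$, $!^{op}:(0,1)$, $\mu^{op}:(1,2)$, $\mathsf 0^{op}:(1,0)$, $\mathsf 1^{op}:(1,0)$, $\mathsf x^{op}:(1,1)$, $\mathsf s_r^{op}:(1,1)$, and $\mathrm{id}_0:(0,0)$, $\mathrm{id}_1:(1,1)$, $\mathrm{sw}:(2,2)$; closed under $c;d$ ($(n,z),(z,m)\mapsto(n,m)$) and $c\oplus d$ ($(n,m),(r,z)\mapsto(n+r,m+z)$). $\mathsf{ACirc}[n,m]$: circuits of sort $(n,m)$. The denotation $[\![c]\!]\subseteq k(x)^n\times k(x)^m$ is compositional ($;$ relational composition, $\oplus$ product) with $[\![\Delta]\!]=\{(p,(p,p))\}$, $[\![!]\!]=\{(p,\bullet)\}$, $[\![\mu]\!]=\{((p,q),p+q)\}$, $[\![\mathsf 0]\!]=\{(\bullet,0)\}$, $[\![\mathsf 1]\!]=\{(\bullet,1)\}$,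 $[\![\mathsf x]\!]=\{(p,xp)\}$, $[\![\mathsf s_r]\!]=\{(p,rp)\}$, mirror images denoting converse relations, $[\![\mathrm{id}_0]\!]=\{(\bullet,\bullet)\}$, $[\![\mathrm{id}_1]\!]=\{(p,p)\}$, $[\![\mathrm{sw}]\!]=\{((p,q),(q,p))\}$, where $\bullet$ is the unique element of $k(x)^0$. -}

module Defs where

open import Level using (Level; _⊔_) renaming (suc to lsuc)
open import Algebra.Bundles using (CommutativeRing)
open import Data.Nat using (ℕ; zero; suc) renaming (_+_ to _+ℕ_)
open import Data.List using (List; []; _∷_; map; _++_)
open import Data.List.Relation.Unary.All using (All)
open import Data.Vec using (Vec; []; _∷_; take; drop)
open import Data.Vec.Relation.Binary.Pointwise.Inductive using (Pointwise)
open import Data.Product using (Σ; ∃; _×_; _,_)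
open import Data.Unit using (⊤)
open import Relation.Nullary using (¬_)

record Field (c ℓ : Level) : Set (lsuc (c ⊔ ℓ)) where
  field
    commutativeRing : CommutativeRing c ℓ
  open CommutativeRing commutativeRing public
  field
    0≉1 : ¬ (0# ≈ 1#)
    inverse : ∀ a → ¬ (a ≈ 0#) → Σ Carrier (λ b → (a * b) ≈ 1#)

-- Polynomials k[x] (coefficient lists, constant term first) and the
-- field of fractions k(x).

module _ {c ℓ : Level} (K : Field c ℓ) where
  open Field K

  Poly : Set c
  Poly = List Carrier

  infixl 6 _+P_
  infixl 7 _*P_

  _+P_ : Poly → Poly → Poly
  [] +P q = q
  (a ∷ p) +P [] = a ∷ p
  (a ∷ p) +P (b ∷ q) = (a + b) ∷ (p +P q)

  scaleP : Carrier → Poly → Poly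
  scaleP r p = map (r *_) p

  _*P_ : Poly → Poly → Poly
  [] *P q = []
  (a ∷ p) *P q = scaleP a q +P (0# ∷ (p *P q))

  negP : Poly → Poly
  negP p = map (-_) p

  xP : Poly → Poly
  xP p = 0# ∷ p

  -- equality of polynomials (up to trailing zero coefficients)
  _≈P_ : Poly → Poly → Set (c ⊔ ℓ)
  p ≈P q = All (_≈ 0#) (p +P negP q)

  -- An element of k(x): a fraction num / den with den a nonzero
  -- polynomial, given with its (nonzero) leading coefficient:
  -- den = denLow ++ [ denLead ].
  record Kx : Set (c ⊔ ℓ) where
    constructor frac
    field
      num     : Poly
      denLow  : Poly
      denLead : Carrier
      denLead≉0 : ¬ (denLead ≈ 0#)
    den : Poly
    den = denLow ++ (denLead ∷ [])
  open Kx public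

module _ {c ℓ : Level} {K : Field c ℓ} where
  open Field K

  infix 4 _≈K_ _≋_

  _≈K_ : Kx K → Kx K → Set (c ⊔ ℓ)
  p ≈K q = _≈P_ K (_*P_ K (num p) (den q)) (_*P_ K (num q) (den p))

  SumK : Kx K → Kx K → Kx K → Set (c ⊔ ℓ)
  SumK p q s =
    _≈P_ K (_*P_ K (_+P_ K (_*P_ K (num p) (den q)) (_*P_ K (num q) (den p))) (den s))
           (_*P_ K (num s) (_*P_ K (den p) (den q)))

  zeroK : Kx K
  zeroK = frac [] [] 1# (λ e → 0≉1 (sym e))

  oneK : Kx K
  oneK = frac (1# ∷ []) [] 1# (λ e → 0≉1 (sym e))

  xK : Kx K → Kx K
  xK (frac n dl d d≉0) = frac (xP K n) dl d d≉0

  sK : Carrier → Kx K → Kx K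
  sK r (frac n dl d d≉0) = frac (scaleP K r n) dl d d≉0

  _≋_ : ∀ {n} → Vec (Kx K) n → Vec (Kx K) n → Set (c ⊔ ℓ)
  _≋_ = Pointwise _≈K_

module _ {c ℓ : Level} (K : Field c ℓ) where
  open Field K

  data Gen : ℕ → ℕ → Set c where
    copy    : Gen 1 2
    discard : Gen 1 0
    add     : Gen 2 1
    zeroG   : Gen 0 1
    oneG    : Gen 0 1
    reg     : Gen 1 1
    amp     : Carrier → Gen 1 1

  infixl 5 _⨾_
  infixl 6 _⊕_

  data ACirc : ℕ → ℕ → Set c where
    gen   : ∀ {n m} → Gen n m → ACirc n m
    mirror : ∀ {n m} → Gen n m → ACirc m n
    id0   : ACirc 0 0
    id1   : ACirc 1 1
    sw    : ACirc 2 2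
    _⨾_   : ∀ {n z m} → ACirc n z → ACirc z m → ACirc n m
    _⊕_   : ∀ {n m r z} → ACirc n m → ACirc r z → ACirc (n +ℕ r) (m +ℕ z)

module _ {c ℓ : Level} {K : Field c ℓ} where
  open Field K

  ⟦_⟧G : ∀ {n m} → Gen K n m → Vec (Kx K) n → Vec (Kx K) m → Set (c ⊔ ℓ)
  ⟦ copy ⟧G (p ∷ []) (q₁ ∷ q₂ ∷ []) = (p ≈K q₁) × (p ≈K q₂)
  ⟦ discard ⟧G (p ∷ []) [] = Level.Lift _ ⊤
  ⟦ add ⟧G (p ∷ q ∷ []) (s ∷ []) = SumK p q s
  ⟦ zeroG ⟧G [] (s ∷ []) = zeroK ≈K s
  ⟦ oneG ⟧G [] (s ∷ []) = oneK ≈K s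
  ⟦ reg ⟧G (p ∷ []) (q ∷ []) = xK p ≈K q
  ⟦ amp r ⟧G (p ∷ []) (q ∷ []) = sK r p ≈K q

  ⟦_⟧ : ∀ {n m} → ACirc K n m → Vec (Kx K) n → Vec (Kx K) m → Set (c ⊔ ℓ)
  ⟦ gen g ⟧ a b = ⟦ g ⟧G a b
  ⟦ mirror g ⟧ a b = ⟦ g ⟧G b a
  ⟦ id0 ⟧ [] [] = Level.Lift _ ⊤
  ⟦ id1 ⟧ (p ∷ []) (q ∷ []) = p ≈K q
  ⟦ sw ⟧ (p ∷ q ∷ []) (q' ∷ p' ∷ []) = (p ≈K p') × (q ≈K q')
  ⟦ _⨾_ {z = z} d e ⟧ a b = Σ (Vec (Kx K) z) (λ w → ⟦ d ⟧ a w × ⟦ e ⟧ w b)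
  ⟦ _⊕_ {n} {m} d e ⟧ a b = ⟦ d ⟧ (take n a) (take m b) × ⟦ e ⟧ (drop n a) (drop m b)

module Submission where

-- A single rational function u = N / D (N, D ∈ k[x], D ≠ 0) is produced by
--
--     1 ⨾ ⟨N⟩ ⨾ ⟨D⟩ᵒᵖ ,
--
-- where ⟨P⟩ : (1,1) is a circuit computing  w ↦ P·w, built from copiers,
-- amplifiers, registers and adders by Horner's rule.  The composite relates
-- • to exactly those w with D·w = N·1, i.e. to w ≈ u: mirroring ⟨D⟩, whose
-- denotation is then the converse relation, is what divides by D.  Vectors
-- are handled by tensoring, and c_v is the mirror image of the state of v.

open import Defs
open import Level using (Level; _⊔_; lift)
open import Data.Nat using (ℕ; zero; suc; _<_; s≤s) renaming (_+_ to _+ℕ_)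
open import Data.Nat.Properties using (m≤n+m)
open import Data.List using ([]; _∷_; _++_; length)
open import Data.List.Reverse using (Reverse; []; _∶_∶ʳ_; reverseView)
open import Data.List.Relation.Unary.All using (All; []; _∷_)
open import Data.Vec using (Vec; []; _∷_)
import Data.Vec.Relation.Binary.Pointwise.Inductive as Pointwise
open import Data.Product using (Σ; _×_; _,_)
open import Data.Maybe using (nothing)
open import Data.Unit using (tt)
open import Relation.Nullary using (¬_)
open import Relation.Binary.PropositionalEquality using (_≡_)
open import Algebra.Bundles using (CommutativeRing)
open import Function.Bundles using (_⇔_; mk⇔)
import Algebra.Solver.Ring.NaturalCoefficients as NaturalCoefficientsSolver
import Relation.Binary.Reasoning.Setoid as SetoidReasoning

-- (1) k[x] is a commutative ring in which nonzero-leading factors cancel.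

module Polynomials {c ℓ : Level} (K : Field c ℓ) where
  open Field K hiding (zero)
  open import Algebra.Properties.Ring ring using (-0#≈0#; x∙y⁻¹≈ε⇒x≈y; x≈y⇒x∙y⁻¹≈ε)

  Pl : Set c
  Pl = Poly K

  infixl 6 _⊞_
  infixl 7 _⊠_
  infix 4 _≐_

  _⊞_ : Pl → Pl → Pl
  _⊞_ = _+P_ K

  _⊠_ : Pl → Pl → Pl
  _⊠_ = _*P_ K

  sc : Carrier → Pl → Pl
  sc = scaleP K

  ng : Pl → Pl
  ng = negP K

  -- The i-th coefficient; coefficient lists are implicitly padded by zeros.
  coeff : Pl → ℕ → Carrier
  coeff [] _ = 0#
  coeff (a ∷ p) zero = a
  coeff (a ∷ p) (suc i) = coeff p i

  -- Coefficientwise equality: the natural equality of polynomials, in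
  -- terms of which all ring laws are proved one coefficient at a time.
  record _≐_ (p q : Pl) : Set ℓ where
    constructor pw
    field at : ∀ i → coeff p i ≈ coeff q i
  open _≐_ public

  ≐-refl : ∀ {p} → p ≐ p
  ≐-refl = pw λ i → refl

  ≐-sym : ∀ {p q} → p ≐ q → q ≐ p
  ≐-sym h = pw λ i → sym (at h i)

  ≐-trans : ∀ {p q r} → p ≐ q → q ≐ r → p ≐ r
  ≐-trans h g = pw λ i → trans (at h i) (at g i)

  ∷-cong : ∀ {a b p q} → a ≈ b → p ≐ q → (a ∷ p) ≐ (b ∷ q)
  ∷-cong h g = pw λ { zero → h ; (suc i) → at g i }

  ∷-≐[] : ∀ {a p} → a ≈ 0# → p ≐ [] → (a ∷ p) ≐ []
  ∷-≐[] h g = pw λ { zero → h ; (suc i) → at g i }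

  coeff-⊞ : ∀ p q i → coeff (p ⊞ q) i ≈ coeff p i + coeff q i
  coeff-⊞ [] q i = sym (+-identityˡ _)
  coeff-⊞ (a ∷ p) [] i = sym (+-identityʳ _)
  coeff-⊞ (a ∷ p) (b ∷ q) zero = refl
  coeff-⊞ (a ∷ p) (b ∷ q) (suc i) = coeff-⊞ p q i

  coeff-sc : ∀ r p i → coeff (sc r p) i ≈ r * coeff p i
  coeff-sc r [] i = sym (zeroʳ r)
  coeff-sc r (a ∷ p) zero = refl
  coeff-sc r (a ∷ p) (suc i) = coeff-sc r p i

  coeff-ng : ∀ p i → coeff (ng p) i ≈ - coeff p i
  coeff-ng [] i = sym -0#≈0#
  coeff-ng (a ∷ p) zero = refl
  coeff-ng (a ∷ p) (suc i) = coeff-ng p i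

  All≈0⇒≐[] : ∀ r → All (_≈ 0#) r → r ≐ []
  All≈0⇒≐[] [] _ = ≐-refl
  All≈0⇒≐[] (a ∷ r) (h ∷ hs) = ∷-≐[] h (All≈0⇒≐[] r hs)

  ≐[]⇒All≈0 : ∀ r → r ≐ [] → All (_≈ 0#) r
  ≐[]⇒All≈0 [] _ = []
  ≐[]⇒All≈0 (a ∷ r) h = at h zero ∷ ≐[]⇒All≈0 r (pw λ i → at h (suc i))

  ≈P⇒≐ : ∀ p q → _≈P_ K p q → p ≐ q
  ≈P⇒≐ p q h = pw λ i → x∙y⁻¹≈ε⇒x≈y _ _ (begin
      coeff p i + - coeff q i      ≈⟨ +-cong refl (coeff-ng q i) ⟨
      coeff p i + coeff (ng q) i   ≈⟨ coeff-⊞ p (ng q) i ⟨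
      coeff (p ⊞ ng q) i           ≈⟨ at (All≈0⇒≐[] _ h) i ⟩
      0#                           ∎)
    where open SetoidReasoning setoid

  ≐⇒≈P : ∀ p q → p ≐ q → _≈P_ K p q
  ≐⇒≈P p q h = ≐[]⇒All≈0 _ (pw λ i →
    trans (coeff-⊞ p (ng q) i) (trans (+-cong refl (coeff-ng q i)) (x≈y⇒x∙y⁻¹≈ε (at h i))))

  ⊞-cong : ∀ {p p' q q'} → p ≐ p' → q ≐ q' → p ⊞ q ≐ p' ⊞ q'
  ⊞-cong {p} {p'} {q} {q'} h g = pw λ i →
    trans (coeff-⊞ p q i) (trans (+-cong (at h i) (at g i)) (sym (coeff-⊞ p' q' i)))

  ⊞-assoc : ∀ p q r → (p ⊞ q) ⊞ r ≐ p ⊞ (q ⊞ r)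
  ⊞-assoc p q r = pw λ i → trans (coeff-⊞ (p ⊞ q) r i) (trans (+-cong (coeff-⊞ p q i) refl)
    (trans (+-assoc _ _ _) (sym (trans (coeff-⊞ p (q ⊞ r) i) (+-cong refl (coeff-⊞ q r i))))))

  ⊞-comm : ∀ p q → p ⊞ q ≐ q ⊞ p
  ⊞-comm p q = pw λ i → trans (coeff-⊞ p q i) (trans (+-comm _ _) (sym (coeff-⊞ q p i)))

  ⊞-identityˡ : ∀ p → [] ⊞ p ≐ p
  ⊞-identityˡ p = ≐-refl

  ⊞-identityʳ : ∀ p → p ⊞ [] ≐ p
  ⊞-identityʳ p = pw λ i → trans (coeff-⊞ p [] i) (+-identityʳ _)

  ng-cong : ∀ {p q} → p ≐ q → ng p ≐ ng q
  ng-cong {p} {q} h = pw λ i → trans (coeff-ng p i) (trans (-‿cong (at h i)) (sym (coeff-ng q i)))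

  ng-inverseˡ : ∀ p → ng p ⊞ p ≐ []
  ng-inverseˡ p = pw λ i → trans (coeff-⊞ (ng p) p i) (trans (+-cong (coeff-ng p i) refl) (-‿inverseˡ _))

  ng-inverseʳ : ∀ p → p ⊞ ng p ≐ []
  ng-inverseʳ p = pw λ i → trans (coeff-⊞ p (ng p) i) (trans (+-cong refl (coeff-ng p i)) (-‿inverseʳ _))

  ⊞-swapˡ : ∀ p q r → p ⊞ (q ⊞ r) ≐ q ⊞ (p ⊞ r)
  ⊞-swapˡ p q r = ≐-trans (≐-sym (⊞-assoc p q r))
    (≐-trans (⊞-cong (⊞-comm p q) (≐-refl {r})) (⊞-assoc q p r))

  ⊞-interchange : ∀ p q r s → (p ⊞ q) ⊞ (r ⊞ s) ≐ (p ⊞ r) ⊞ (q ⊞ s)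
  ⊞-interchange p q r s = ≐-trans (⊞-assoc p q (r ⊞ s))
    (≐-trans (⊞-cong (≐-refl {p}) (⊞-swapˡ q r s)) (≐-sym (⊞-assoc p r (q ⊞ s))))

  sc-cong : ∀ {a b p q} → a ≈ b → p ≐ q → sc a p ≐ sc b q
  sc-cong {a} {b} {p} {q} h g = pw λ i →
    trans (coeff-sc a p i) (trans (*-cong h (at g i)) (sym (coeff-sc b q i)))

  sc-distribʳ : ∀ a b p → sc (a + b) p ≐ sc a p ⊞ sc b p
  sc-distribʳ a b p = pw λ i → trans (coeff-sc (a + b) p i) (trans (distribʳ _ a b)
    (sym (trans (coeff-⊞ (sc a p) (sc b p) i) (+-cong (coeff-sc a p i) (coeff-sc b p i)))))

  sc-distribˡ : ∀ a p q → sc a (p ⊞ q) ≐ sc a p ⊞ sc a q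
  sc-distribˡ a p q = pw λ i → trans (coeff-sc a (p ⊞ q) i) (trans (*-cong refl (coeff-⊞ p q i))
    (trans (distribˡ a _ _) (sym (trans (coeff-⊞ (sc a p) (sc a q) i) (+-cong (coeff-sc a p i) (coeff-sc a q i))))))

  sc-assoc : ∀ a b p → sc a (sc b p) ≐ sc (a * b) p
  sc-assoc a b p = pw λ i → trans (coeff-sc a (sc b p) i) (trans (*-cong refl (coeff-sc b p i))
    (trans (sym (*-assoc a b _)) (sym (coeff-sc (a * b) p i))))

  sc-zero : ∀ p → sc 0# p ≐ []
  sc-zero p = pw λ i → trans (coeff-sc 0# p i) (zeroˡ _)

  sc-one : ∀ p → sc 1# p ≐ p
  sc-one p = pw λ i → trans (coeff-sc 1# p i) (*-identityˡ _)

  -- Multiplication; a ∷ p stands for a + x·p, so  (a ∷ p)·q = a·q + x·(p·q).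
  ⊠-zeroʳ : ∀ p → p ⊠ [] ≐ []
  ⊠-zeroʳ [] = ≐-refl
  ⊠-zeroʳ (a ∷ p) = ∷-≐[] refl (⊠-zeroʳ p)

  ⊠-by-≐[] : ∀ p q → p ≐ [] → p ⊠ q ≐ []
  ⊠-by-≐[] [] q h = ≐-refl
  ⊠-by-≐[] (a ∷ p) q h =
    ⊞-cong (≐-trans (sc-cong (at h zero) (≐-refl {q})) (sc-zero q))
           (∷-≐[] refl (⊠-by-≐[] p q (pw λ i → at h (suc i))))

  ⊠-congʳ : ∀ {p p'} q → p ≐ p' → p ⊠ q ≐ p' ⊠ q
  ⊠-congʳ {[]} {[]} q h = ≐-refl
  ⊠-congʳ {[]} {b ∷ p'} q h = ≐-sym (⊠-by-≐[] (b ∷ p') q (≐-sym h))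
  ⊠-congʳ {a ∷ p} {[]} q h = ⊠-by-≐[] (a ∷ p) q h
  ⊠-congʳ {a ∷ p} {b ∷ p'} q h =
    ⊞-cong (sc-cong (at h zero) (≐-refl {q})) (∷-cong refl (⊠-congʳ {p} {p'} q (pw λ i → at h (suc i))))

  ⊠-∷ʳ : ∀ p b q → p ⊠ (b ∷ q) ≐ sc b p ⊞ (0# ∷ p ⊠ q)
  ⊠-∷ʳ [] b q = ≐-sym (∷-≐[] refl ≐-refl)
  ⊠-∷ʳ (a ∷ p) b q =
    ∷-cong (trans (+-identityʳ _) (trans (*-comm a b) (sym (+-identityʳ _))))
           (≐-trans (⊞-cong (≐-refl {sc a q}) (⊠-∷ʳ p b q)) (⊞-swapˡ (sc a q) (sc b p) _))

  ⊠-comm : ∀ p q → p ⊠ q ≐ q ⊠ p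
  ⊠-comm [] q = ≐-sym (⊠-zeroʳ q)
  ⊠-comm (a ∷ p) q = ≐-trans (⊞-cong (≐-refl {sc a q}) (∷-cong refl (⊠-comm p q))) (≐-sym (⊠-∷ʳ q a p))

  ⊠-congˡ : ∀ p {q q'} → q ≐ q' → p ⊠ q ≐ p ⊠ q'
  ⊠-congˡ p {q} {q'} h = ≐-trans (⊠-comm p q) (≐-trans (⊠-congʳ p h) (⊠-comm q' p))

  ⊠-distribʳ : ∀ p q r → (p ⊞ q) ⊠ r ≐ p ⊠ r ⊞ q ⊠ r
  ⊠-distribʳ [] q r = ≐-refl
  ⊠-distribʳ (a ∷ p) [] r = ≐-sym (⊞-identityʳ _)
  ⊠-distribʳ (a ∷ p) (b ∷ q) r =
    ≐-trans (⊞-cong (sc-distribʳ a b r) (∷-cong (sym (+-identityʳ 0#)) (⊠-distribʳ p q r)))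
            (⊞-interchange (sc a r) (sc b r) (0# ∷ p ⊠ r) (0# ∷ q ⊠ r))

  ⊠-distribˡ : ∀ p q r → p ⊠ (q ⊞ r) ≐ p ⊠ q ⊞ p ⊠ r
  ⊠-distribˡ p q r = ≐-trans (⊠-comm p (q ⊞ r))
    (≐-trans (⊠-distribʳ q r p) (⊞-cong (⊠-comm q p) (⊠-comm r p)))

  sc-⊠ : ∀ a q r → sc a q ⊠ r ≐ sc a (q ⊠ r)
  sc-⊠ a [] r = ≐-refl
  sc-⊠ a (b ∷ q) r = ≐-sym (≐-trans (sc-distribˡ a (sc b r) (0# ∷ q ⊠ r))
    (⊞-cong (sc-assoc a b r) (∷-cong (zeroʳ a) (≐-sym (sc-⊠ a q r)))))

  x-⊠ : ∀ p r → (0# ∷ p) ⊠ r ≐ 0# ∷ (p ⊠ r)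
  x-⊠ p r = ⊞-cong (sc-zero r) (≐-refl {0# ∷ p ⊠ r})

  ⊠-assoc : ∀ p q r → (p ⊠ q) ⊠ r ≐ p ⊠ (q ⊠ r)
  ⊠-assoc [] q r = ≐-refl
  ⊠-assoc (a ∷ p) q r =
    ≐-trans (⊠-distribʳ (sc a q) (0# ∷ p ⊠ q) r)
      (⊞-cong (sc-⊠ a q r) (≐-trans (x-⊠ (p ⊠ q) r) (∷-cong refl (⊠-assoc p q r))))

  ⊠-identityˡ : ∀ p → (1# ∷ []) ⊠ p ≐ p
  ⊠-identityˡ p = ≐-trans (⊞-cong (sc-one p) (∷-≐[] refl ≐-refl)) (⊞-identityʳ p)

  ⊠-identityʳ : ∀ p → p ⊠ (1# ∷ []) ≐ p
  ⊠-identityʳ p = ≐-trans (⊠-comm p _) (⊠-identityˡ p)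

  -- k[x] is a commutative ring; this gives access to the ring solver.
  polyRing : CommutativeRing c ℓ
  polyRing = record
    { Carrier = Pl ; _≈_ = _≐_ ; _+_ = _⊞_ ; _*_ = _⊠_ ; -_ = ng ; 0# = [] ; 1# = 1# ∷ []
    ; isCommutativeRing = record
      { isRing = record
        { +-isAbelianGroup = record
          { isGroup = record
            { isMonoid = record
              { isSemigroup = record
                { isMagma = record
                  { isEquivalence = record { refl = ≐-refl ; sym = ≐-sym ; trans = ≐-trans }
                  ; ∙-cong = ⊞-cong }
                ; assoc = ⊞-assoc }
              ; identity = ⊞-identityˡ , ⊞-identityʳ }
            ; inverse = ng-inverseˡ , ng-inverseʳ
            ; ⁻¹-cong = ng-cong }
          ; comm = ⊞-comm }
        ; *-cong = λ {p} {p'} {q} {q'} h g → ≐-trans (⊠-congʳ q h) (⊠-congˡ p' g)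
        ; *-assoc = ⊠-assoc
        ; *-identity = ⊠-identityˡ , ⊠-identityʳ
        ; distrib = ⊠-distribˡ , (λ r p q → ⊠-distribʳ p q r) }
      ; *-comm = ⊠-comm } }

  module PolySolver =
    NaturalCoefficientsSolver (CommutativeRing.commutativeSemiring polyRing) (λ _ _ → nothing)

  cancel-nonzero : ∀ {a d} → ¬ (d ≈ 0#) → a * d ≈ 0# → a ≈ 0#
  cancel-nonzero {a} {d} d≉0 ad≈0 with inverse d d≉0
  ... | e , de≈1 = begin
      a            ≈⟨ *-identityʳ a ⟨
      a * 1#       ≈⟨ *-cong refl de≈1 ⟨
      a * (d * e)  ≈⟨ *-assoc a d e ⟨
      (a * d) * e  ≈⟨ *-cong ad≈0 refl ⟩
      0# * e       ≈⟨ zeroˡ e ⟩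
      0#           ∎
    where open SetoidReasoning setoid

  coeff-last : ∀ dl d → coeff (dl ++ d ∷ []) (length dl) ≡ d
  coeff-last [] d = _≡_.refl
  coeff-last (e ∷ dl) d = coeff-last dl d

  coeff-beyond : ∀ dl d i → length dl < i → coeff (dl ++ d ∷ []) i ≡ 0#
  coeff-beyond [] d (suc i) _ = _≡_.refl
  coeff-beyond (e ∷ dl) d (suc i) (s≤s h) = coeff-beyond dl d i h

  coeff-top-⊠ : ∀ r a dl d → coeff ((r ++ a ∷ []) ⊠ (dl ++ d ∷ [])) (length r +ℕ length dl) ≈ a * d
  coeff-top-⊠ [] a dl d =
    trans (coeff-⊞ (sc a D) (0# ∷ []) (length dl))
      (trans (+-cong (coeff-sc a D (length dl)) (at (∷-≐[] refl ≐-refl) (length dl)))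
        (trans (+-identityʳ _) (*-cong refl (reflexive (coeff-last dl d)))))
    where D = dl ++ d ∷ []
  coeff-top-⊠ (b ∷ r) a dl d =
    trans (coeff-⊞ (sc b D) (0# ∷ (r ++ a ∷ []) ⊠ D) (suc (length r +ℕ length dl)))
      (trans (+-cong (trans (coeff-sc b D _)
                       (trans (*-cong refl (reflexive (coeff-beyond dl d _ (s≤s (m≤n+m (length dl) (length r))))))
                              (zeroʳ b)))
                     (coeff-top-⊠ r a dl d))
             (+-identityˡ _))
    where D = dl ++ d ∷ []

  -- A polynomial with nonzero leading coefficient d is not a zero divisor:
  -- peel off the top coefficient of r, which must vanish by coeff-top-⊠.
  module _ (dl : Pl) (d : Carrier) (d≉0 : ¬ (d ≈ 0#)) where
    private
      D : Pl
      D = dl ++ d ∷ []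

    drop-zero-last : ∀ r a → a ≈ 0# → (r ++ a ∷ []) ≐ r
    drop-zero-last [] a h = ∷-≐[] h ≐-refl
    drop-zero-last (b ∷ r) a h = ∷-cong refl (drop-zero-last r a h)

    no-zero-divisor : ∀ {r} → Reverse r → r ⊠ D ≐ [] → r ≐ []
    no-zero-divisor [] _ = ≐-refl
    no-zero-divisor (r ∶ view ∶ʳ a) h =
      ≐-trans (drop-zero-last r a a≈0) (no-zero-divisor view (≐-trans (⊠-congʳ D (≐-sym (drop-zero-last r a a≈0))) h))
      where
        a≈0 : a ≈ 0#
        a≈0 = cancel-nonzero d≉0 (trans (sym (coeff-top-⊠ r a dl d)) (at h (length r +ℕ length dl)))

    ⊠-cancelʳ : ∀ p q → p ⊠ D ≐ q ⊠ D → p ≐ q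
    ⊠-cancelʳ p q h = begin
        p                 ≈⟨ ⊞-identityʳ p ⟨
        p ⊞ []            ≈⟨ ⊞-cong (≐-refl {p}) (ng-inverseˡ q) ⟨
        p ⊞ (ng q ⊞ q)    ≈⟨ ⊞-assoc p (ng q) q ⟨
        (p ⊞ ng q) ⊞ q    ≈⟨ ⊞-cong difference≐[] (≐-refl {q}) ⟩
        q                 ∎
      where
        open SetoidReasoning (CommutativeRing.setoid polyRing)
        difference≐[] : p ⊞ ng q ≐ []
        difference≐[] = no-zero-divisor (reverseView _) (begin
            (p ⊞ ng q) ⊠ D          ≈⟨ ⊠-distribʳ p (ng q) D ⟩
            p ⊠ D ⊞ ng q ⊠ D        ≈⟨ ⊞-cong h (≐-refl {ng q ⊠ D}) ⟩
            q ⊠ D ⊞ ng q ⊠ D        ≈⟨ ⊠-distribʳ q (ng q) D ⟨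
            (q ⊞ ng q) ⊠ D          ≈⟨ ⊠-by-≐[] _ D (ng-inverseʳ q) ⟩
            []                      ∎)

-- (2) k(x): the equivalence ≈K and the relations denoted by the generators.

module RationalFunctions {c ℓ : Level} (K : Field c ℓ) where
  open Field K hiding (zero)
  open Polynomials K
  open SetoidReasoning (CommutativeRing.setoid polyRing)
  open PolySolver using (solve; _:=_) renaming (_:+_ to _+'_; _:*_ to _*'_)

  KX : Set (c ⊔ ℓ)
  KX = Kx K

  ≈K⇒cross : ∀ {p q : KX} → p ≈K q → num p ⊠ den q ≐ num q ⊠ den p
  ≈K⇒cross h = ≈P⇒≐ _ _ h

  cross⇒≈K : ∀ {p q : KX} → num p ⊠ den q ≐ num q ⊠ den p → p ≈K q
  cross⇒≈K h = ≐⇒≈P _ _ h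

  cancel-den : ∀ (q : KX) X Y → X ⊠ den q ≐ Y ⊠ den q → X ≐ Y
  cancel-den q = ⊠-cancelʳ (denLow q) (denLead q) (denLead≉0 q)

  ⊠-swapʳ : ∀ x y z → (x ⊠ y) ⊠ z ≐ (x ⊠ z) ⊠ y
  ⊠-swapʳ = solve 3 (λ x y z → (x *' y) *' z := (x *' z) *' y) ≐-refl

  ≈K-refl : ∀ {p : KX} → p ≈K p
  ≈K-refl {p} = cross⇒≈K {p} {p} ≐-refl

  ≈K-sym : ∀ {p q : KX} → p ≈K q → q ≈K p
  ≈K-sym {p} {q} h = cross⇒≈K {q} {p} (≐-sym (≈K⇒cross {p} {q} h))

  -- Transitivity is where cancellation of the middle denominator is needed.
  ≈K-trans : ∀ {p q r : KX} → p ≈K q → q ≈K r → p ≈K r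
  ≈K-trans {p} {q} {r} h g = cross⇒≈K {p} {r} (cancel-den q _ _ (begin
      (num p ⊠ den r) ⊠ den q ≈⟨ ⊠-swapʳ (num p) (den r) (den q) ⟩
      (num p ⊠ den q) ⊠ den r ≈⟨ ⊠-congʳ (den r) (≈K⇒cross {p} {q} h) ⟩
      (num q ⊠ den p) ⊠ den r ≈⟨ ⊠-swapʳ (num q) (den p) (den r) ⟩
      (num q ⊠ den r) ⊠ den p ≈⟨ ⊠-congʳ (den p) (≈K⇒cross {q} {r} g) ⟩
      (num r ⊠ den q) ⊠ den p ≈⟨ ⊠-swapʳ (num r) (den q) (den p) ⟩
      (num r ⊠ den p) ⊠ den q ∎))

  polyMul : Pl → KX → KX
  polyMul P p = frac (P ⊠ num p) (denLow p) (denLead p) (denLead≉0 p)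

  polyMul-cong : ∀ P {p q : KX} → p ≈K q → polyMul P p ≈K polyMul P q
  polyMul-cong P {p} {q} h = cross⇒≈K {polyMul P p} {polyMul P q} (begin
      (P ⊠ num p) ⊠ den q ≈⟨ ⊠-assoc P (num p) (den q) ⟩
      P ⊠ (num p ⊠ den q) ≈⟨ ⊠-congˡ P (≈K⇒cross {p} {q} h) ⟩
      P ⊠ (num q ⊠ den p) ≈⟨ ⊠-assoc P (num q) (den p) ⟨
      (P ⊠ num q) ⊠ den p ∎)

  sK-cong : ∀ r {p q : KX} → p ≈K q → sK r p ≈K sK r q
  sK-cong r {p} {q} h = cross⇒≈K {sK r p} {sK r q} (begin
      sc r (num p) ⊠ den q ≈⟨ sc-⊠ r (num p) (den q) ⟩
      sc r (num p ⊠ den q) ≈⟨ sc-cong refl (≈K⇒cross {p} {q} h) ⟩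
      sc r (num q ⊠ den p) ≈⟨ sc-⊠ r (num q) (den p) ⟨
      sc r (num q) ⊠ den p ∎)

  xK-cong : ∀ {p q : KX} → p ≈K q → xK p ≈K xK q
  xK-cong {p} {q} h = cross⇒≈K {xK p} {xK q} (begin
      (0# ∷ num p) ⊠ den q ≈⟨ x-⊠ (num p) (den q) ⟩
      0# ∷ num p ⊠ den q   ≈⟨ ∷-cong refl (≈K⇒cross {p} {q} h) ⟩
      0# ∷ num q ⊠ den p   ≈⟨ x-⊠ (num q) (den p) ⟨
      (0# ∷ num q) ⊠ den p ∎)

  polyMul-[]-sound : ∀ (w z : KX) → zeroK ≈K z → polyMul [] w ≈K z
  polyMul-[]-sound w z h = cross⇒≈K {polyMul [] w} {z} (≐-sym (⊠-by-≐[] (num z) (den w) num-z≐[]))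
    where
      num-z≐[] : num z ≐ []
      num-z≐[] = ≐-trans (≐-sym (⊠-identityʳ (num z))) (≐-sym (≈K⇒cross {zeroK} {z} h))

  polyMul-[]-complete : ∀ (w z : KX) → polyMul [] w ≈K z → zeroK ≈K z
  polyMul-[]-complete w z h = cross⇒≈K {zeroK} {z} (≐-sym (≐-trans (⊠-identityʳ (num z)) num-z≐[]))
    where
      num-z≐[] : num z ≐ []
      num-z≐[] = cancel-den w (num z) [] (≐-sym (≈K⇒cross {polyMul [] w} {z} h))

  module _ (dl : Pl) (d : Carrier) (d≉0 : ¬ (d ≈ 0#)) where
    private
      E : Pl
      E = dl ++ d ∷ []

      over : Pl → KX
      over N = frac N dl d d≉0

    sum-sound : ∀ NA NB (y₁ y₂ z : KX) → over NA ≈K y₁ → over NB ≈K y₂ →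
                SumK y₁ y₂ z → over (NA ⊞ NB) ≈K z
    sum-sound NA NB y₁ y₂ z h₁ h₂ h = cross⇒≈K {over (NA ⊞ NB)} {z} (cancel-den y₁ _ _ (cancel-den y₂ _ _ (begin
        (((NA ⊞ NB) ⊠ Dz) ⊠ D₁) ⊠ D₂
          ≈⟨ solve 5 (λ a b z x y → (((a +' b) *' z) *' x) *' y :=
                        ((a *' x) *' (y *' z)) +' ((b *' y) *' (x *' z))) ≐-refl NA NB Dz D₁ D₂ ⟩
        ((NA ⊠ D₁) ⊠ (D₂ ⊠ Dz)) ⊞ ((NB ⊠ D₂) ⊠ (D₁ ⊠ Dz))
          ≈⟨ ⊞-cong (⊠-congʳ (D₂ ⊠ Dz) (≈K⇒cross {over NA} {y₁} h₁))
                    (⊠-congʳ (D₁ ⊠ Dz) (≈K⇒cross {over NB} {y₂} h₂)) ⟩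
        ((N₁ ⊠ E) ⊠ (D₂ ⊠ Dz)) ⊞ ((N₂ ⊠ E) ⊠ (D₁ ⊠ Dz))
          ≈⟨ solve 6 (λ n₁ n₂ e y x z → ((n₁ *' e) *' (y *' z)) +' ((n₂ *' e) *' (x *' z)) :=
                        e *' (((n₁ *' y) +' (n₂ *' x)) *' z)) ≐-refl N₁ N₂ E D₂ D₁ Dz ⟩
        E ⊠ (((N₁ ⊠ D₂) ⊞ (N₂ ⊠ D₁)) ⊠ Dz)
          ≈⟨ ⊠-congˡ E (≈P⇒≐ _ _ h) ⟩
        E ⊠ (num z ⊠ (D₁ ⊠ D₂))
          ≈⟨ solve 4 (λ e n x y → e *' (n *' (x *' y)) := ((n *' e) *' x) *' y) ≐-refl E (num z) D₁ D₂ ⟩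
        ((num z ⊠ E) ⊠ D₁) ⊠ D₂ ∎)))
      where
        D₁ = den y₁
        D₂ = den y₂
        Dz = den z
        N₁ = num y₁
        N₂ = num y₂

    sum-complete : ∀ NA NB (z : KX) → over (NA ⊞ NB) ≈K z → SumK (over NA) (over NB) z
    sum-complete NA NB z h = ≐⇒≈P _ _ (begin
        ((NA ⊠ E) ⊞ (NB ⊠ E)) ⊠ den z
          ≈⟨ solve 4 (λ a b e z → ((a *' e) +' (b *' e)) *' z := ((a +' b) *' z) *' e) ≐-refl NA NB E (den z) ⟩
        ((NA ⊞ NB) ⊠ den z) ⊠ E ≈⟨ ⊠-congʳ E (≈K⇒cross {over (NA ⊞ NB)} {z} h) ⟩
        (num z ⊠ E) ⊠ E         ≈⟨ ⊠-assoc (num z) E E ⟩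
        num z ⊠ (E ⊠ E)         ∎)

-- (3) Circuits for multiplication by a polynomial, mirror images, states.

module Circuits {c ℓ : Level} (K : Field c ℓ) where
  open Field K hiding (zero)
  open Polynomials K
  open RationalFunctions K

  -- ⟨P⟩ computes w ↦ P·w by Horner's rule:  (a + x·P')·w = a·w + x·(P'·w),
  -- i.e. copy w, amplify one copy by a, feed the other through ⟨P'⟩ and
  -- the register, and add.
  mulCirc : Pl → ACirc K 1 1
  mulCirc [] = gen discard ⨾ gen zeroG
  mulCirc (a ∷ P) = gen copy ⨾ (gen (amp a) ⊕ (mulCirc P ⨾ gen reg)) ⨾ gen add

  mulCirc-sound : ∀ P (w z : KX) → ⟦ mulCirc P ⟧ (w ∷ []) (z ∷ []) → polyMul P w ≈K z
  mulCirc-sound [] w z ([] , _ , h) = polyMul-[]-sound w z h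
  mulCirc-sound (a ∷ P) w z
    ((y₁ ∷ y₂ ∷ []) , ((v₁ ∷ v₂ ∷ []) , (w≈v₁ , w≈v₂) , (amplified , ((t ∷ []) , recursive , registered))) , summed) =
    sum-sound (denLow w) (denLead w) (denLead≉0 w) (sc a (num w)) (0# ∷ P ⊠ num w) y₁ y₂ z
      (≈K-trans {sK a w} {sK a v₁} {y₁} (sK-cong a {w} {v₁} w≈v₁) amplified)
      (≈K-trans {xK (polyMul P w)} {xK t} {y₂}
        (xK-cong {polyMul P w} {t}
          (≈K-trans {polyMul P w} {polyMul P v₂} {t} (polyMul-cong P {w} {v₂} w≈v₂) (mulCirc-sound P v₂ t recursive)))
        registered)
      summed

  mulCirc-complete : ∀ P (w z : KX) → polyMul P w ≈K z → ⟦ mulCirc P ⟧ (w ∷ []) (z ∷ [])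
  mulCirc-complete [] w z h = [] , lift tt , polyMul-[]-complete w z h
  mulCirc-complete (a ∷ P) w z h =
    (sK a w ∷ xK (polyMul P w) ∷ []) ,
    ((w ∷ w ∷ []) , (≈K-refl {w} , ≈K-refl {w}) ,
      (≈K-refl {sK a w} ,
       ((polyMul P w ∷ []) ,
        mulCirc-complete P w (polyMul P w) (≈K-refl {polyMul P w}) ,
        ≈K-refl {xK (polyMul P w)}))) ,
    sum-complete (denLow w) (denLead w) (denLead≉0 w) (sc a (num w)) (0# ∷ P ⊠ num w) z h

  mirrorCirc : ∀ {n m} → ACirc K n m → ACirc K m n
  mirrorCirc (gen g) = mirror g
  mirrorCirc (mirror g) = gen g
  mirrorCirc id0 = id0
  mirrorCirc id1 = id1
  mirrorCirc sw = sw
  mirrorCirc (d ⨾ e) = mirrorCirc e ⨾ mirrorCirc d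
  mirrorCirc (d ⊕ e) = mirrorCirc d ⊕ mirrorCirc e

  mirror-sound : ∀ {n m} (d : ACirc K n m) a b → ⟦ d ⟧ a b → ⟦ mirrorCirc d ⟧ b a
  mirror-sound (gen g) a b h = h
  mirror-sound (mirror g) a b h = h
  mirror-sound id0 [] [] h = h
  mirror-sound id1 (p ∷ []) (q ∷ []) h = ≈K-sym {p} {q} h
  mirror-sound sw (p ∷ q ∷ []) (q' ∷ p' ∷ []) (h₁ , h₂) = ≈K-sym {q} {q'} h₂ , ≈K-sym {p} {p'} h₁
  mirror-sound (d ⨾ e) a b (w , h₁ , h₂) = w , mirror-sound e w b h₂ , mirror-sound d a w h₁
  mirror-sound (d ⊕ e) a b (h₁ , h₂) = mirror-sound d _ _ h₁ , mirror-sound e _ _ h₂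

  mirror-complete : ∀ {n m} (d : ACirc K n m) a b → ⟦ mirrorCirc d ⟧ b a → ⟦ d ⟧ a b
  mirror-complete (gen g) a b h = h
  mirror-complete (mirror g) a b h = h
  mirror-complete id0 [] [] h = h
  mirror-complete id1 (p ∷ []) (q ∷ []) h = ≈K-sym {q} {p} h
  mirror-complete sw (p ∷ q ∷ []) (q' ∷ p' ∷ []) (h₁ , h₂) = ≈K-sym {p'} {p} h₂ , ≈K-sym {q'} {q} h₁
  mirror-complete (d ⨾ e) a b (w , h₁ , h₂) = w , mirror-complete d a w h₂ , mirror-complete e w b h₁
  mirror-complete (d ⊕ e) a b (h₁ , h₂) = mirror-complete d _ _ h₁ , mirror-complete e _ _ h₂

  pointCirc : KX → ACirc K 0 1
  pointCirc u = gen oneG ⨾ mulCirc (num u) ⨾ mirrorCirc (mulCirc (den u))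

  pointCirc-sound : ∀ (u w : KX) → ⟦ pointCirc u ⟧ [] (w ∷ []) → w ≈K u
  pointCirc-sound u w ((y ∷ []) , ((s ∷ []) , s-one , numerator) , denominator) =
    cross⇒≈K {w} {u} (cancel-den s _ _ (begin
      (num w ⊠ D) ⊠ den s ≈⟨ ⊠-congʳ (den s) (⊠-comm (num w) D) ⟩
      (D ⊠ num w) ⊠ den s ≈⟨ ≈K⇒cross {polyMul D w} {polyMul N s} Dw≈Ns ⟩
      (N ⊠ num s) ⊠ den w ≈⟨ ⊠-congʳ (den w) (⊠-congˡ N den≐num) ⟨
      (N ⊠ den s) ⊠ den w ≈⟨ ⊠-swapʳ N (den s) (den w) ⟩
      (N ⊠ den w) ⊠ den s ∎))
    where
      open SetoidReasoning (CommutativeRing.setoid polyRing)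
      N = num u
      D = den u
      -- both D·w and N·s equal the intermediate wire y
      Dw≈Ns : polyMul D w ≈K polyMul N s
      Dw≈Ns = ≈K-trans {polyMul D w} {y} {polyMul N s}
        (mulCirc-sound D w y (mirror-complete (mulCirc D) (w ∷ []) (y ∷ []) denominator))
        (≈K-sym {polyMul N s} {y} (mulCirc-sound N s y numerator))
      den≐num : den s ≐ num s
      den≐num = ≐-trans (≐-sym (⊠-identityˡ (den s)))
        (≐-trans (≈K⇒cross {oneK} {s} s-one) (⊠-identityʳ (num s)))

  pointCirc-complete : ∀ (u w : KX) → w ≈K u → ⟦ pointCirc u ⟧ [] (w ∷ [])
  pointCirc-complete u w w≈u =
    (polyMul N oneK ∷ []) ,
    ((oneK ∷ []) , ≈K-refl {oneK} , mulCirc-complete N oneK (polyMul N oneK) (≈K-refl {polyMul N oneK})) ,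
    mirror-sound (mulCirc D) (w ∷ []) (polyMul N oneK ∷ []) (mulCirc-complete D w (polyMul N oneK) Dw≈N)
    where
      open SetoidReasoning (CommutativeRing.setoid polyRing)
      N = num u
      D = den u
      Dw≈N : polyMul D w ≈K polyMul N oneK
      Dw≈N = cross⇒≈K {polyMul D w} {polyMul N oneK} (begin
        (D ⊠ num w) ⊠ (1# ∷ [])  ≈⟨ ⊠-identityʳ _ ⟩
        D ⊠ num w                ≈⟨ ⊠-comm D (num w) ⟩
        num w ⊠ D                ≈⟨ ≈K⇒cross {w} {u} w≈u ⟩
        N ⊠ den w                ≈⟨ ⊠-congʳ (den w) (⊠-identityʳ N) ⟨
        (N ⊠ (1# ∷ [])) ⊠ den w  ∎)

  stateCirc : ∀ {n} → Vec KX n → ACirc K 0 n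
  stateCirc [] = id0
  stateCirc (p ∷ u) = pointCirc p ⊕ stateCirc u

  stateCirc-sound : ∀ {n} (u w : Vec KX n) → ⟦ stateCirc u ⟧ [] w → w ≋ u
  stateCirc-sound [] [] _ = Pointwise.[]
  stateCirc-sound (p ∷ u) (w ∷ ws) (h₁ , h₂) = pointCirc-sound p w h₁ Pointwise.∷ stateCirc-sound u ws h₂

  stateCirc-complete : ∀ {n} (u w : Vec KX n) → w ≋ u → ⟦ stateCirc u ⟧ [] w
  stateCirc-complete [] [] _ = lift tt
  stateCirc-complete (p ∷ u) (w ∷ ws) (h Pointwise.∷ hs) = pointCirc-complete p w h , stateCirc-complete u ws hs

proposition2 : ∀ {c ℓ : Level} (K : Field c ℓ) {n m : ℕ}
    (u : Vec (Kx K) n) (v : Vec (Kx K) m) →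
    Σ (ACirc K 0 n) (λ cu → Σ (ACirc K m 0) (λ cv →
    (∀ w → ⟦ cu ⟧ [] w ⇔ (w ≋ u)) ×
    (∀ w → ⟦ cv ⟧ w [] ⇔ (w ≋ v))))
proposition2 K u v =
  stateCirc u , mirrorCirc (stateCirc v) ,
  (λ w → mk⇔ (stateCirc-sound u w) (stateCirc-complete u w)) ,
  (λ w → mk⇔ (λ h → stateCirc-sound v w (mirror-complete (stateCirc v) [] w h))
             (λ w≋v → mirror-sound (stateCirc v) [] w (stateCirc-complete v w w≋v)))
  where open Circuits K
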